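{- If a rooted forest-tuple $F$ is suitable, then $t(F)\ge 4$.
   Context: A rooted forest is a forest each of whose components contains exactly one distinguished vertex, its root. A rooted forest-tuple is a tuple $F=(F_1,\ldots,F_\ell)$ of pairwise vertex-disjoint rooted forests such that $e(F_i)>0$ for some $i$; $e(F)=\sum_i e(F_i)$. Define $a(F)=\max\{e(F_i): i\in[\ell]\}$, $k(F)=|\{i\in[\ell]: e(F_i)=a(F)\}|$, and $t(F)=|\{i\in[\ell]: e(F_i)>0\}|$. $F$ is called suitable if $3a(F)+k(F)-e(F)\le 2$, or if $a(F)=1$ and $t(F)\ge 4$. -}

module Defs where

open import Level using (Level)
open import Data.Nat using (ℕ; zero; suc; _+_; _*_; _≤_; _<_; _⊔_)
open import Data.Fin using (Fin)
open import Data.List using (List; map; allFin; foldr)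
open import Data.Nat.ListAction using (sum)
open import Data.Maybe using (Maybe; just; nothing)
open import Data.Product using (∃; _×_)
open import Data.Sum using (_⊎_)
open import Relation.Binary.PropositionalEquality using (_≡_; _≢_)
open import Relation.Nullary using (does)
open import Data.Bool using (if_then_else_)
open import Data.Nat using (_≟_; _<?_)
open import Induction.WellFounded using (WellFounded)
open import Function.Definitions using (Injective)

Σ[<_]_ : (n : ℕ) → (Fin n → ℕ) → ℕ
Σ[< n ] f = sum (map f (allFin n))

-- A rooted forest with vertices labelled in V, encoded by parent pointers:
-- every vertex either is a root (parent = nothing) or has a parent; the
-- "is a child of" relation is well-founded (no cycles). Each component
-- then contains exactly one root, and the edges are the pairs
-- {v, parent v}, one per non-root vertex.
record RootedForest (V : Set) : Set where
  field
    size       : ℕ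
    vertex     : Fin size → V
    vertex-inj : Injective _≡_ _≡_ vertex
    parent     : Fin size → Maybe (Fin size)
    acyclic    : WellFounded (λ x y → parent x ≡ just y)

open RootedForest public

isNonRoot : ∀ {n} → Maybe (Fin n) → ℕ
isNonRoot (just _) = 1
isNonRoot nothing  = 0

edges : ∀ {V} → RootedForest V → ℕ
edges F = Σ[< size F ] (λ v → isNonRoot (parent F v))

record ForestTuple (V : Set) : Set where
  field
    len      : ℕ
    forest   : Fin len → RootedForest V
    disjoint : ∀ i j → i ≢ j → ∀ u w → vertex (forest i) u ≢ vertex (forest j) w
    someEdge : ∃ λ i → 0 < edges (forest i)

open ForestTuple public

eT : ∀ {V} → ForestTuple V → ℕ
eT F = Σ[< len F ] (λ i → edges (forest F i))

aT : ∀ {V} → ForestTuple V → ℕ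
aT F = foldr _⊔_ 0 (map (λ i → edges (forest F i)) (allFin (len F)))

kT : ∀ {V} → ForestTuple V → ℕ
kT F = Σ[< len F ] (λ i → if does (edges (forest F i) ≟ aT F) then 1 else 0)

tT : ∀ {V} → ForestTuple V → ℕ
tT F = Σ[< len F ] (λ i → if does (0 <? edges (forest F i)) then 1 else 0)

-- suitable: 3a + k − e ≤ 2 (integer inequality, written without truncated
-- subtraction as 3a + k ≤ 2 + e), or (a = 1 and t ≥ 4)
Suitable : ∀ {V} → ForestTuple V → Set
Suitable F = (3 * aT F + kT F ≤ 2 + eT F) ⊎ (aT F ≡ 1 × 4 ≤ tT F)

{-# OPTIONS --safe #-}
module Submission where

-- With a the largest edge count, every nonempty F_i has e(F_i) + 1 ≤ a,
-- except the k forests attaining a, where e(F_i) + 1 = a + 1; summing,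
-- e + t ≤ a·t + k. Combined with 3a + k ≤ 2 + e this gives 3a + t ≤ 2 + a·t,
-- i.e. (a − 1)(t − 3) ≥ 1, so t ≥ 4.

open import Defs
open import Data.Nat using (ℕ; zero; suc; _+_; _*_; _≤_; _<_; _⊔_; z≤n; _≟_; _<?_)
open import Data.Nat.Properties
open import Data.Nat.ListAction using (sum)
open import Data.Nat.Tactic.RingSolver using (solve)
open import Data.List using ([]; _∷_; map; foldr; allFin)
open import Data.List.Properties using (foldr-forcesᵇ)
open import Data.List.Relation.Unary.All as All using (All)
open import Data.List.Relation.Unary.All.Properties using (map⁻)
open import Data.List.Membership.Propositional.Properties using (∈-allFin)
open import Data.Bool using (if_then_else_)
open import Data.Product using (_×_; _,_; proj₁; proj₂)
open import Data.Sum using (inj₁; inj₂)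
open import Function using (_∘_)
open import Relation.Nullary using (Dec; does; yes; no)
open import Relation.Binary.PropositionalEquality using (_≡_; refl; sym; cong; trans)
open import Algebra.Properties.CommutativeSemigroup +-commutativeSemigroup using (interchange)

module _ {A : Set} where

  sum-map-+ : ∀ (f g : A → ℕ) xs →
              sum (map (λ x → f x + g x) xs) ≡ sum (map f xs) + sum (map g xs)
  sum-map-+ f g []       = refl
  sum-map-+ f g (x ∷ xs) =
    trans (cong (f x + g x +_) (sum-map-+ f g xs)) (interchange (f x) (g x) _ _)

  sum-map-*ˡ : ∀ c (f : A → ℕ) xs → sum (map (λ x → c * f x) xs) ≡ c * sum (map f xs)
  sum-map-*ˡ c f []       = sym (*-zeroʳ c)
  sum-map-*ˡ c f (x ∷ xs) =
    trans (cong (c * f x +_) (sum-map-*ˡ c f xs)) (sym (*-distribˡ-+ c (f x) _))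

  sum-map-mono-≤ : ∀ {f g : A → ℕ} → (∀ x → f x ≤ g x) → ∀ xs →
                   sum (map f xs) ≤ sum (map g xs)
  sum-map-mono-≤ f≤g []       = z≤n
  sum-map-mono-≤ f≤g (x ∷ xs) = +-mono-≤ (f≤g x) (sum-map-mono-≤ f≤g xs)

foldr-⊔-upperBound : ∀ ns → All (_≤ foldr _⊔_ 0 ns) ns
foldr-⊔-upperBound ns = foldr-forcesᵇ split 0 ns ≤-refl
  where
  split : ∀ {o} m n → m ⊔ n ≤ o → m ≤ o × n ≤ o
  split m n m⊔n≤o = m⊔n≤o⇒m≤o m n m⊔n≤o , m⊔n≤o⇒n≤o m n m⊔n≤o

isPositive : ℕ → ℕ
isPositive n = if does (0 <? n) then 1 else 0

isEqualTo : ℕ → ℕ → ℕ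
isEqualTo a n = if does (n ≟ a) then 1 else 0

n≤a⇒n+[0<n]≤a*[0<n]+[n≡a] : ∀ {a} n → n ≤ a →
                              n + isPositive n ≤ a * isPositive n + isEqualTo a n
n≤a⇒n+[0<n]≤a*[0<n]+[n≡a] {a} zero    _   rewrite *-zeroʳ a = z≤n
n≤a⇒n+[0<n]≤a*[0<n]+[n≡a] {a} (suc m) m<a = split (suc m ≟ a)
  where
  split : (d : Dec (suc m ≡ a)) → suc m + 1 ≤ a * 1 + (if does d then 1 else 0)
  split (yes refl) rewrite *-identityʳ m = ≤-refl
  split (no m≢a)   rewrite *-identityʳ a | +-identityʳ a | +-comm (suc m) 1 = ≤∧≢⇒< m<a m≢a

module _ {I : Set} (f : I → ℕ) {a} (f≤a : ∀ x → f x ≤ a) where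

  sum+countPositive≤ : ∀ xs →
    sum (map f xs) + sum (map (isPositive ∘ f) xs) ≤
    a * sum (map (isPositive ∘ f) xs) + sum (map (isEqualTo a ∘ f) xs)
  sum+countPositive≤ xs = begin
    sum (map f xs) + sum (map (isPositive ∘ f) xs)
      ≡⟨ sum-map-+ f (isPositive ∘ f) xs ⟨
    sum (map (λ x → f x + isPositive (f x)) xs)
      ≤⟨ sum-map-mono-≤ (λ x → n≤a⇒n+[0<n]≤a*[0<n]+[n≡a] (f x) (f≤a x)) xs ⟩
    sum (map (λ x → a * isPositive (f x) + isEqualTo a (f x)) xs)
      ≡⟨ sum-map-+ (λ x → a * isPositive (f x)) (isEqualTo a ∘ f) xs ⟩
    sum (map (λ x → a * isPositive (f x)) xs) + sum (map (isEqualTo a ∘ f) xs)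
      ≡⟨ cong (_+ sum (map (isEqualTo a ∘ f) xs)) (sum-map-*ˡ a (isPositive ∘ f) xs) ⟩
    a * sum (map (isPositive ∘ f) xs) + sum (map (isEqualTo a ∘ f) xs) ∎
    where open ≤-Reasoning

+-≤-elim : ∀ {x y z t e k} → x + k ≤ y + e → e + t ≤ z + k → x + t ≤ y + z
+-≤-elim {x} {y} {z} {t} {e} {k} x+k≤y+e e+t≤z+k =
  +-cancelʳ-≤ (e + k) (x + t) (y + z) (begin
  x + t + (e + k)       ≡⟨ solve (x ∷ t ∷ e ∷ k ∷ []) ⟩
  (x + k) + (e + t)     ≤⟨ +-mono-≤ x+k≤y+e e+t≤z+k ⟩
  (y + e) + (z + k)     ≡⟨ solve (y ∷ e ∷ z ∷ k ∷ []) ⟩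
  y + z + (e + k)       ∎)
  where open ≤-Reasoning

3a+t≤2+at⇒3<t : ∀ {a t} → 0 < a → 3 * a + t ≤ 2 + a * t → 3 < t
3a+t≤2+at⇒3<t {suc b} {t} _ 3a+t≤2+at =
  *-cancelˡ-< b 3 t (+-cancelʳ-≤ (2 + t) (suc (b * 3)) (b * t) (begin
  suc (b * 3) + (2 + t) ≡⟨ solve (b ∷ t ∷ []) ⟩
  3 * suc b + t         ≤⟨ 3a+t≤2+at ⟩
  2 + suc b * t         ≡⟨ solve (b ∷ t ∷ []) ⟩
  b * t + (2 + t)       ∎))
  where open ≤-Reasoning

module _ {V : Set} (F : ForestTuple V) where

  edges≤aT : ∀ i → edges (forest F i) ≤ aT F
  edges≤aT i = All.lookup (map⁻ (foldr-⊔-upperBound _)) (∈-allFin i)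

  0<aT : 0 < aT F
  0<aT = ≤-trans (proj₂ (someEdge F)) (edges≤aT (proj₁ (someEdge F)))

  eT+tT≤aT*tT+kT : eT F + tT F ≤ aT F * tT F + kT F
  eT+tT≤aT*tT+kT = sum+countPositive≤ (edges ∘ forest F) edges≤aT (allFin (len F))

lemma3p5 : {V : Set} (F : ForestTuple V) → Suitable F → 4 ≤ tT F
lemma3p5 F (inj₁ 3a+k≤2+e)  =
  3a+t≤2+at⇒3<t (0<aT F) (+-≤-elim {k = kT F} 3a+k≤2+e (eT+tT≤aT*tT+kT F))
lemma3p5 F (inj₂ (_ , 4≤t)) = 4≤t
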